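{- Let $G=(V,E)$ be a strongly connected directed graph and $s\in V$. Let $r$ be a marked vertex and let $v$ be a vertex that is not a descendant of $r$ in $D(s)$. Then there is a path from $v$ to $r$ in $G$ that contains no vertex of $T(r)\setminus\{r\}$. Moreover, every simple path from $v$ to any vertex of $T(r)$ contains the edge $(d(r),r)$.
   Context: $G(s)$ is the flow graph with start vertex $s$; $u$ dominates $x$ if every path from $s$ to $x$ contains $u$ (reflexive). $D(s)$ is the dominator tree (rooted at $s$, $u$ ancestor of $x$ iff $u$ dominates $x$), and $d(x)$ the parent of $x\neq s$. An edge $(y,x)$ is a bridge of $G(s)$ if every path from $s$ to $x$ contains it (then $y=d(x)$). A vertex $x$ is marked if $(d(x),x)$ is a bridge of $G(s)$. Deleting from $D(s)$ all edges $(d(x),x)$ with $x$ marked yields a forest; $T(x)$ denotes the tree of this forest containing $x$, rooted at $s$ or at a marked vertex (so $T(r)$ is rooted at $r$ for marked $r$). -}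

module Defs where

open import Data.Nat using (ℕ)
open import Data.Fin using (Fin)
open import Data.List using (List; []; _∷_)
open import Data.List.Membership.Propositional using (_∈_)
open import Data.List.Relation.Unary.Unique.Propositional using (Unique)
open import Data.Product using (Σ; _×_)
open import Relation.Binary.PropositionalEquality using (_≡_)
open import Relation.Nullary using (¬_)

-- A directed graph on the vertex set Fin n is given by its edge relation
-- E : Fin n → Fin n → Set  (E u w  means there is an edge (u , w)).

data Walk {n : ℕ} (E : Fin n → Fin n → Set) : Fin n → Fin n → Set where
  stop : (u : Fin n) → Walk E u u
  _∷_  : {u w v : Fin n} → E u w → Walk E w v → Walk E u v

infixr 5 _∷_

verts : {n : ℕ} {E : Fin n → Fin n → Set} {u v : Fin n} → Walk E u v → List (Fin n)
verts (stop u) = u ∷ []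
verts {u = u} (_ ∷ p) = u ∷ verts p

_∈W_ : {n : ℕ} {E : Fin n → Fin n → Set} {u v : Fin n} → Fin n → Walk E u v → Set
x ∈W p = x ∈ verts p

Simple : {n : ℕ} {E : Fin n → Fin n → Set} {u v : Fin n} → Walk E u v → Set
Simple p = Unique (verts p)

data EdgeIn {n : ℕ} {E : Fin n → Fin n → Set} (y x : Fin n) :
            {u v : Fin n} → Walk E u v → Set where
  here  : {v : Fin n} {e : E y x} {p : Walk E x v} → EdgeIn y x (e ∷ p)
  there : {u w v : Fin n} {e : E u w} {p : Walk E w v} →
          EdgeIn y x p → EdgeIn y x (e ∷ p)

StronglyConnected : {n : ℕ} → (Fin n → Fin n → Set) → Set
StronglyConnected {n} E = (u w : Fin n) → Walk E u w

Dominates : {n : ℕ} → (Fin n → Fin n → Set) → Fin n → Fin n → Fin n → Set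
Dominates {n} E s u x = (p : Walk E s x) → u ∈W p

-- y = d(x), the parent of x ≠ s in the dominator tree D(s) (immediate
-- dominator): y is a proper dominator of x dominated by every proper
-- dominator of x.
IDom : {n : ℕ} → (Fin n → Fin n → Set) → Fin n → Fin n → Fin n → Set
IDom {n} E s y x =
  ¬ (x ≡ s) × Dominates E s y x × ¬ (y ≡ x) ×
  ((z : Fin n) → Dominates E s z x → ¬ (z ≡ x) → Dominates E s z y)

Bridge : {n : ℕ} → (Fin n → Fin n → Set) → Fin n → Fin n → Fin n → Set
Bridge {n} E s y x = E y x × ((p : Walk E s x) → EdgeIn y x p)

Marked : {n : ℕ} → (Fin n → Fin n → Set) → Fin n → Fin n → Set
Marked {n} E s x = ¬ (x ≡ s) × Σ (Fin n) (λ y → IDom E s y x × Bridge E s y x)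

-- w ∈ T(r) for a marked vertex r: w is a descendant of r in D(s), and the
-- tree path from r to w in D(s) contains no marked vertex other than r
-- (so no deleted edge (d(z), z) lies between r and w).
InT : {n : ℕ} → (Fin n → Fin n → Set) → Fin n → Fin n → Fin n → Set
InT {n} E s r w =
  Dominates E s r w ×
  ((z : Fin n) → Marked E s z → Dominates E s r z → Dominates E s z w → z ≡ r)

-- Both parts rest on one construction: the first-visit prefix of a walk
-- u ⇝ x, i.e. the walk cut at its first arrival at x.  Every vertex z ≠ x on
-- that prefix is reachable from u by a walk avoiding x.  Since r does not
-- dominate v, some walk s ⇝ v avoids r; this holds only up to double
-- negation, so all conclusions are proved for decidable propositions (vertex
-- equality, edge membership) and recovered by stability.
--  (1) Take the first-visit prefix of any walk v ⇝ r.  A vertex w ≠ r on it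
--      is reachable as s ⇝ v ⇝ w avoiding r, so r does not dominate w and w
--      is not in T(r).
--  (2) For p : v ⇝ w with w in T(r), the walk s ⇝ v ⇝ w must meet r, hence p
--      meets r.  The walk s ⇝ v followed by the first-visit prefix of p at r
--      contains the bridge, which cannot lie on the r-avoiding part s ⇝ v.
-- Finally, the immediate dominator is unique (dominance is antisymmetric on
-- reachable vertices), so the bridge of the marking is the edge (y, r) for
-- any immediate dominator y of r.
module Submission where

open import Defs
open import Data.Nat using (ℕ)
open import Data.Fin using (Fin; _≟_)
open import Data.Product using (Σ; _×_; _,_; proj₁)
open import Data.Sum using (_⊎_; inj₁; inj₂; [_,_])
open import Data.Empty using (⊥; ⊥-elim)
open import Data.List.Relation.Unary.Any using (here; there)
import Data.List.Membership.DecPropositional as DecMembership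
open import Function using (_∘_)
open import Relation.Binary.PropositionalEquality using (_≡_; refl; sym)
open import Relation.Nullary using (¬_; Dec; yes; no)
open import Relation.Nullary.Decidable using (decidable-stable)

Avoiding : {n : ℕ} → (Fin n → Fin n → Set) → Fin n → Fin n → Fin n → Set
Avoiding E x u z = Σ (Walk E u z) λ t → ¬ (x ∈W t)

module _ {n : ℕ} {E : Fin n → Fin n → Set} where

  _++W_ : {a b c : Fin n} → Walk E a b → Walk E b c → Walk E a c
  stop _ ++W p = p
  (e ∷ q) ++W p = e ∷ (q ++W p)

  end∈ : {u v : Fin n} (p : Walk E u v) → v ∈W p
  end∈ (stop _) = here refl
  end∈ (e ∷ p) = there (end∈ p)

  ∈-++⁻ : {a b c z : Fin n} (q : Walk E a b) (p : Walk E b c) →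
          z ∈W (q ++W p) → z ∈W q ⊎ z ∈W p
  ∈-++⁻ (stop _) p m = inj₂ m
  ∈-++⁻ (e ∷ q) p (here eq) = inj₁ (here eq)
  ∈-++⁻ (e ∷ q) p (there m) with ∈-++⁻ q p m
  ... | inj₁ m' = inj₁ (there m')
  ... | inj₂ m' = inj₂ m'

  EdgeIn-++⁻ : {a b c y x : Fin n} (q : Walk E a b) (p : Walk E b c) →
               EdgeIn y x (q ++W p) → EdgeIn y x q ⊎ EdgeIn y x p
  EdgeIn-++⁻ (stop _) p h = inj₂ h
  EdgeIn-++⁻ (e ∷ q) p here = inj₁ here
  EdgeIn-++⁻ (e ∷ q) p (there h) with EdgeIn-++⁻ q p h
  ... | inj₁ h' = inj₁ (there h')
  ... | inj₂ h' = inj₂ h'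

  EdgeIn⇒head∈ : {u v y x : Fin n} {p : Walk E u v} → EdgeIn y x p → x ∈W p
  EdgeIn⇒head∈ {p = _ ∷ stop _} here = there (here refl)
  EdgeIn⇒head∈ {p = _ ∷ (_ ∷ _)} here = there (here refl)
  EdgeIn⇒head∈ (there h) = there (EdgeIn⇒head∈ h)

  edgeIn? : (y x : Fin n) {u v : Fin n} (p : Walk E u v) → Dec (EdgeIn y x p)
  edgeIn? y x (stop _) = no λ ()
  edgeIn? y x {u} (_∷_ {w = w} e p) with u ≟ y | w ≟ x | edgeIn? y x p
  ... | yes refl | yes refl | _ = yes here
  ... | _ | _ | yes h = yes (there h)
  ... | no u≢y | _ | no ¬h = no λ { here → u≢y refl ; (there h) → ¬h h }
  ... | yes _ | no w≢x | no ¬h = no λ { here → w≢x refl ; (there h) → ¬h h }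

  avoiding-++ : {x a b c : Fin n} →
                Avoiding E x a b → Avoiding E x b c → Avoiding E x a c
  avoiding-++ (q , x∉q) (t , x∉t) =
    q ++W t , λ x∈ → [ x∉q , x∉t ] (∈-++⁻ q t x∈)

  avoiding-stop : {x u : Fin n} → ¬ (u ≡ x) → Avoiding E x u u
  avoiding-stop {u = u} u≢x = stop u , λ { (here x≡u) → u≢x (sym x≡u) ; (there ()) }

  avoiding-∷ : {x u w z : Fin n} → E u w → ¬ (u ≡ x) →
               Avoiding E x w z → Avoiding E x u z
  avoiding-∷ e u≢x (t , x∉t) =
    e ∷ t , λ { (here x≡u) → u≢x (sym x≡u) ; (there x∈t) → x∉t x∈t }

  record FirstVisit {u v : Fin n} (x : Fin n) (p : Walk E u v) : Set where
    field
      prefix        : Walk E u x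
      prefix-edges  : {a b : Fin n} → EdgeIn a b prefix → EdgeIn a b p
      prefix-avoids : {z : Fin n} → z ∈W prefix → ¬ (z ≡ x) → Avoiding E x u z
  open FirstVisit

  visitAtStart : {x v : Fin n} (p : Walk E x v) → FirstVisit x p
  visitAtStart {x} p = record
    { prefix        = stop x
    ; prefix-edges  = λ ()
    ; prefix-avoids = λ { (here refl) z≢x → ⊥-elim (z≢x refl) ; (there ()) _ }
    }

  visitAfter : {u w v x : Fin n} (e : E u w) {p : Walk E w v} → ¬ (u ≡ x) →
               FirstVisit x p → FirstVisit x (e ∷ p)
  visitAfter e u≢x fv = record
    { prefix        = e ∷ prefix fv
    ; prefix-edges  = λ { here → here ; (there h) → there (prefix-edges fv h) }
    ; prefix-avoids = λ
        { (here refl) _   → avoiding-stop u≢x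
        ; (there z∈) z≢x → avoiding-∷ e u≢x (prefix-avoids fv z∈ z≢x)
        }
    }

  firstVisit : {u v : Fin n} (x : Fin n) (p : Walk E u v) → x ∈W p → FirstVisit x p
  firstVisit x (stop u) (here refl) = visitAtStart (stop u)
  firstVisit {u} x (e ∷ p) x∈ with u ≟ x
  ... | yes refl = visitAtStart (e ∷ p)
  ... | no u≢x with x∈
  ...   | here x≡u  = ⊥-elim (u≢x (sym x≡u))
  ...   | there x∈p = visitAfter e u≢x (firstVisit x p x∈p)

  -- A vertex that r does not dominate is reachable from s avoiding r, up to
  -- double negation (membership of r on a given walk is decidable).
  ¬dominates⇒¬¬avoiding : {s r v : Fin n} → ¬ Dominates E s r v → ¬ ¬ Avoiding E r s v
  ¬dominates⇒¬¬avoiding {r = r} r∤v ¬avoid = r∤v λ p →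
    decidable-stable (DecMembership._∈?_ _≟_ r (verts p)) λ r∉p → ¬avoid (p , r∉p)

  dominates-antisym : {s y y′ : Fin n} → Walk E s y →
                      Dominates E s y y′ → Dominates E s y′ y → y ≡ y′
  dominates-antisym {y = y} {y′} p y⊒y′ y′⊒y = decidable-stable (y ≟ y′) λ y≢y′ →
    let (t , y∉t) = prefix-avoids fv (y′⊒y (prefix fv)) (y≢y′ ∘ sym) in y∉t (y⊒y′ t)
    where
    -- Cutting p at its first visit to y: y′ lies before y there, hence
    -- is reachable avoiding y, contradicting y ⊒ y′.
    fv : FirstVisit y p
    fv = firstVisit y p (end∈ p)

  idom-unique : {s x y y′ : Fin n} → Walk E s y →
                IDom E s y x → IDom E s y′ x → y ≡ y′
  idom-unique p (_ , y⊒x , y≢x , y-below) (_ , y′⊒x , y′≢x , y′-below) =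
    dominates-antisym p (y′-below _ y⊒x y≢x) (y-below _ y′⊒x y′≢x)

  escape-route : {s r v : Fin n} → ¬ Dominates E s r v → Walk E v r →
                 Σ (Walk E v r) λ p → (w : Fin n) → w ∈W p → Dominates E s r w → w ≡ r
  escape-route {r = r} r∤v p = prefix fv , λ w w∈ r⊒w →
    decidable-stable (w ≟ r) λ w≢r → ¬dominates⇒¬¬avoiding r∤v λ q →
      let (t , r∉t) = avoiding-++ q (prefix-avoids fv w∈ w≢r) in r∉t (r⊒w t)
    where
    fv : FirstVisit r p
    fv = firstVisit r p (end∈ p)

  enters-through-bridge : {s r v w y : Fin n} → ¬ Dominates E s r v →
                          Bridge E s y r → Dominates E s r w →
                          (p : Walk E v w) → EdgeIn y r p
  enters-through-bridge {s} {r} {v} {y = y} r∤v (_ , bridge) r⊒w p =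
    decidable-stable (edgeIn? y r p) λ y→r∉p →
      ¬dominates⇒¬¬avoiding r∤v λ { (q , r∉q) →
        through q r∉q y→r∉p (∈-++⁻ q p (r⊒w (q ++W p))) }
    where
    -- r lies on s ⇝ v ⇝ w but not on the first piece, so p visits r and the
    -- bridge must lie on the first-visit prefix of p at r.
    through : (q : Walk E s v) → ¬ (r ∈W q) → ¬ EdgeIn y r p → r ∈W q ⊎ r ∈W p → ⊥
    through q r∉q _ (inj₁ r∈q) = r∉q r∈q
    through q r∉q y→r∉p (inj₂ r∈p) =
      [ r∉q ∘ EdgeIn⇒head∈ , y→r∉p ∘ prefix-edges fv ]
        (EdgeIn-++⁻ q (prefix fv) (bridge (q ++W prefix fv)))
      where
      fv : FirstVisit r p
      fv = firstVisit r p r∈p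

lemma7 : (n : ℕ) (E : Fin n → Fin n → Set) → StronglyConnected E →
         (s r v : Fin n) → Marked E s r → ¬ Dominates E s r v →
         Σ (Walk E v r) (λ p → (w : Fin n) → w ∈W p → InT E s r w → w ≡ r)
         × ((w : Fin n) → InT E s r w → (p : Walk E v w) → Simple p →
            (y : Fin n) → IDom E s y r → EdgeIn y r p)
lemma7 n E sc s r v (_ , y₀ , idom₀ , bridge₀) r∤v = part1 , part2
  where
  part1 : Σ (Walk E v r) (λ p → (w : Fin n) → w ∈W p → InT E s r w → w ≡ r)
  part1 with escape-route r∤v (sc v r)
  ... | p , only-r = p , λ w w∈p w∈T → only-r w w∈p (proj₁ w∈T)

  part2 : (w : Fin n) → InT E s r w → (p : Walk E v w) → Simple p →
          (y : Fin n) → IDom E s y r → EdgeIn y r p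
  part2 w w∈T p _ y idom rewrite idom-unique (sc s y) idom idom₀ =
    enters-through-bridge r∤v bridge₀ (proj₁ w∈T) p
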